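{- Let $n\ge 3$ and $D_n=\langle a,b\mid a^n=b^2=1,\ ab=ba^{ -1}\rangle$. Then $\Gamma_N(D_n)$ has no edges (is totally disconnected) if and only if $n$ is an odd prime.
   Context: $\Gamma_N(G)$ denotes the simple graph whose vertices are the proper non-normal subgroups of the group $G$, two distinct vertices $H,K$ being adjacent iff $HK=KH$. -}

module Defs where

open import Data.Nat using (ℕ; zero; suc; _+_; _∸_; _%_)
open import Data.Nat.DivMod using (m%n<n)
open import Data.Fin using (Fin; toℕ; fromℕ<)
open import Data.Bool using (Bool; true; false; _xor_; if_then_else_)
open import Data.Product using (_×_; _,_; Σ; ∃; ∃-syntax)
open import Relation.Binary.PropositionalEquality using (_≡_; _≢_)
open import Relation.Nullary using (¬_)

_+ₙ_ : ∀ {n} → Fin n → Fin n → Fin n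
_+ₙ_ {suc n} i j = fromℕ< (m%n<n (toℕ i + toℕ j) (suc n))

-ₙ_ : ∀ {n} → Fin n → Fin n
-ₙ_ {suc n} i = fromℕ< (m%n<n (suc n ∸ toℕ i) (suc n))

-- The dihedral group D_n = ⟨a,b | aⁿ = b² = 1, ab = ba⁻¹⟩ of order 2n.
-- The element (s , i) represents a^i b^s  (s = true means the factor b is present).
D : ℕ → Set
D n = Bool × Fin n

-- (a^i b^s)(a^j b^t) = a^(i + (-1)^s j) b^(s+t)
_·_ : ∀ {n} → D n → D n → D n
(s , i) · (t , j) = (s xor t , i +ₙ (if s then -ₙ j else j))

inv : ∀ {n} → D n → D n
inv (false , i) = (false , -ₙ i)
inv (true , i) = (true , i)

-- Subsets of D n, represented decidably as Bool-valued predicates (D n is finite).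
Subset : ℕ → Set
Subset n = D n → Bool

_∈_ : ∀ {n} → D n → Subset n → Set
x ∈ H = H x ≡ true

record IsSubgroup {n : ℕ} (H : Subset n) : Set where
  field
    nonempty : ∃[ x ] (x ∈ H)
    ·-closed : ∀ x y → x ∈ H → y ∈ H → (x · y) ∈ H
    inv-closed : ∀ x → x ∈ H → inv x ∈ H

IsProper : ∀ {n} → Subset n → Set
IsProper H = ∃[ x ] ¬ (x ∈ H)

IsNormal : ∀ {n} → Subset n → Set
IsNormal H = ∀ g h → h ∈ H → ((g · h) · inv g) ∈ H

-- vertices of Γ_N(D n): proper non-normal subgroups
IsVertex : ∀ {n} → Subset n → Set
IsVertex H = IsSubgroup H × IsProper H × ¬ IsNormal H

_∈_⋆_ : ∀ {n} → D n → Subset n → Subset n → Set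
x ∈ H ⋆ K = ∃[ h ] ∃[ k ] (h ∈ H × k ∈ K × x ≡ h · k)

Permute : ∀ {n} → Subset n → Subset n → Set
Permute H K = ∀ x → (x ∈ H ⋆ K → x ∈ K ⋆ H) × (x ∈ K ⋆ H → x ∈ H ⋆ K)

Distinct : ∀ {n} → Subset n → Subset n → Set
Distinct H K = ∃[ x ] (H x ≢ K x)

NoEdges : ℕ → Set
NoEdges n = ∀ (H K : Subset n) → IsVertex H → IsVertex K → Distinct H K → ¬ Permute H K

module Submission where

open import Defs
open import Level using (0ℓ)
open import Data.Nat using (ℕ; zero; suc; _+_; _*_; _∸_; _%_; _<_; _≤_; s≤s; z≤n; NonZero)
open import Data.Nat.Base using (≢-nonZero; nonTrivial⇒n>1)
open import Data.Nat.Properties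
  using (+-comm; +-assoc; +-identityʳ; *-comm; *-identityʳ; m+[n∸m]≡n; <⇒≤; n<1+n; ≤-antisym; ≤⇒≯; ≤-<-trans; m<m*n; m≤n⇒m<n∨m≡n)
open import Data.Nat.DivMod using (%-distribˡ-+; m%n%n≡m%n; m<n⇒m%n≡m; n%n≡0; [m+kn]%n≡m%n; %-pred-≡0; m*n%n≡0)
open import Data.Nat.Divisibility
  using (_∣_; divides; _∣?_; _∣0; ∣-refl; ∣-trans; ∣⇒≤; n∣m⇒m%n≡0; m%n≡0⇒n∣m; %-presˡ-∣; ∣m∣n⇒∣m+n; ∣m+n∣m⇒∣n)
open import Data.Nat.Divisibility.Core using (hasNonTrivialDivisor)
open import Data.Nat.Primality using (Prime; Composite; euclidsLemma; prime?; ¬prime⇒composite)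
open import Data.Nat.Coprimality using (prime⇒coprime; coprime-Bézout)
open import Data.Nat.GCD using (module Bézout)
open import Data.Fin using (Fin; toℕ; zero; suc; fromℕ<)
import Data.Fin as Fin
open import Data.Fin.Properties using (toℕ-fromℕ<; toℕ-injective; toℕ<n; any?)
open import Data.Bool using (true; false)
import Data.Bool as Bool
open import Data.Bool.Properties using (⇔→≡; T-≡)
open import Data.Product using (_×_; _,_; proj₁; proj₂; ∃-syntax)
open import Data.Sum using (_⊎_; inj₁; inj₂)
open import Function.Base using (_∘_)
open import Function.Bundles using (_⇔_; mk⇔; Equivalence)
open import Relation.Nullary using (¬_; contradiction)
open import Relation.Nullary.Decidable using (decidable-stable; isYes; toWitness; fromWitness)
open import Algebra.Structures using (IsAbelianGroup)
open import Algebra.Bundles using (AbelianGroup)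
open import Relation.Binary.PropositionalEquality
open ≡-Reasoning

one : {m : ℕ} → Fin (suc (suc m))
one = suc zero

large∤small : {d m : ℕ} .{{_ : NonZero m}} → 3 ≤ d → m < 3 → ¬ d ∣ m
large∤small 3≤d m<3 d∣m = ≤⇒≯ 3≤d (≤-<-trans (∣⇒≤ d∣m) m<3)

module ZMod (m : ℕ) where

  N : ℕ
  N = suc m

  toℕ-+ₙ : (i j : Fin N) → toℕ (i +ₙ j) ≡ (toℕ i + toℕ j) % N
  toℕ-+ₙ i j = toℕ-fromℕ< _

  toℕ--ₙ : (i : Fin N) → toℕ (-ₙ i) ≡ (N ∸ toℕ i) % N
  toℕ--ₙ i = toℕ-fromℕ< _

  %-absorbˡ : ∀ a b → (a % N + b) % N ≡ (a + b) % N
  %-absorbˡ a b = begin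
    (a % N + b) % N           ≡⟨ %-distribˡ-+ (a % N) b N ⟩
    (a % N % N + b % N) % N   ≡⟨ cong (λ z → (z + b % N) % N) (m%n%n≡m%n a N) ⟩
    (a % N + b % N) % N       ≡⟨ %-distribˡ-+ a b N ⟨
    (a + b) % N               ∎

  %-absorbʳ : ∀ a b → (a + b % N) % N ≡ (a + b) % N
  %-absorbʳ a b = begin
    (a + b % N) % N   ≡⟨ cong (_% N) (+-comm a (b % N)) ⟩
    (b % N + a) % N   ≡⟨ %-absorbˡ b a ⟩
    (b + a) % N       ≡⟨ cong (_% N) (+-comm b a) ⟩
    (a + b) % N       ∎

  +ₙ-comm : (i j : Fin N) → i +ₙ j ≡ j +ₙ i
  +ₙ-comm i j = toℕ-injective (begin
    toℕ (i +ₙ j)         ≡⟨ toℕ-+ₙ i j ⟩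
    (toℕ i + toℕ j) % N  ≡⟨ cong (_% N) (+-comm (toℕ i) (toℕ j)) ⟩
    (toℕ j + toℕ i) % N  ≡⟨ toℕ-+ₙ j i ⟨
    toℕ (j +ₙ i)         ∎)

  +ₙ-assoc : (i j k : Fin N) → (i +ₙ j) +ₙ k ≡ i +ₙ (j +ₙ k)
  +ₙ-assoc i j k = toℕ-injective (begin
    toℕ ((i +ₙ j) +ₙ k)                 ≡⟨ toℕ-+ₙ (i +ₙ j) k ⟩
    (toℕ (i +ₙ j) + toℕ k) % N          ≡⟨ cong (λ z → (z + toℕ k) % N) (toℕ-+ₙ i j) ⟩
    ((toℕ i + toℕ j) % N + toℕ k) % N   ≡⟨ %-absorbˡ (toℕ i + toℕ j) (toℕ k) ⟩
    (toℕ i + toℕ j + toℕ k) % N         ≡⟨ cong (_% N) (+-assoc (toℕ i) (toℕ j) (toℕ k)) ⟩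
    (toℕ i + (toℕ j + toℕ k)) % N       ≡⟨ %-absorbʳ (toℕ i) (toℕ j + toℕ k) ⟨
    (toℕ i + (toℕ j + toℕ k) % N) % N   ≡⟨ cong (λ z → (toℕ i + z) % N) (toℕ-+ₙ j k) ⟨
    (toℕ i + toℕ (j +ₙ k)) % N          ≡⟨ toℕ-+ₙ i (j +ₙ k) ⟨
    toℕ (i +ₙ (j +ₙ k))                 ∎)

  +ₙ-identityˡ : (i : Fin N) → zero +ₙ i ≡ i
  +ₙ-identityˡ i = toℕ-injective (trans (toℕ-+ₙ zero i) (m<n⇒m%n≡m (toℕ<n i)))

  +ₙ-identityʳ : (i : Fin N) → i +ₙ zero ≡ i
  +ₙ-identityʳ i = trans (+ₙ-comm i zero) (+ₙ-identityˡ i)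

  +ₙ-inverseʳ : (i : Fin N) → i +ₙ (-ₙ i) ≡ zero
  +ₙ-inverseʳ i = toℕ-injective (begin
    toℕ (i +ₙ (-ₙ i))               ≡⟨ toℕ-+ₙ i (-ₙ i) ⟩
    (toℕ i + toℕ (-ₙ i)) % N        ≡⟨ cong (λ z → (toℕ i + z) % N) (toℕ--ₙ i) ⟩
    (toℕ i + (N ∸ toℕ i) % N) % N   ≡⟨ %-absorbʳ (toℕ i) (N ∸ toℕ i) ⟩
    (toℕ i + (N ∸ toℕ i)) % N       ≡⟨ cong (_% N) (m+[n∸m]≡n (<⇒≤ (toℕ<n i))) ⟩
    N % N                           ≡⟨ n%n≡0 N ⟩
    0                               ∎)

  +ₙ-inverseˡ : (i : Fin N) → (-ₙ i) +ₙ i ≡ zero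
  +ₙ-inverseˡ i = trans (+ₙ-comm (-ₙ i) i) (+ₙ-inverseʳ i)

  +ₙ-isAbelianGroup : IsAbelianGroup _≡_ _+ₙ_ zero -ₙ_
  +ₙ-isAbelianGroup = record
    { isGroup = record
      { isMonoid = record
        { isSemigroup = record { isMagma = isMagma _+ₙ_ ; assoc = +ₙ-assoc }
        ; identity = +ₙ-identityˡ , +ₙ-identityʳ
        }
      ; inverse = +ₙ-inverseˡ , +ₙ-inverseʳ
      ; ⁻¹-cong = cong -ₙ_
      }
    ; comm = +ₙ-comm
    }

  ℤ/N : AbelianGroup 0ℓ 0ℓ
  ℤ/N = record { isAbelianGroup = +ₙ-isAbelianGroup }

  open import Algebra.Properties.AbelianGroup ℤ/N public
    using (⁻¹-involutive; ε⁻¹≈ε; x∙y⁻¹≈ε⇒x≈y; ⁻¹-anti-homo‿-)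
  open import Algebra.Definitions.RawMonoid (AbelianGroup.rawMonoid ℤ/N) public
    using () renaming (_×_ to _×ₙ_)

  toℕ-×ₙ : (c : ℕ) (i : Fin N) → toℕ (c ×ₙ i) ≡ (c * toℕ i) % N
  toℕ-×ₙ zero i = refl
  toℕ-×ₙ (suc c) i = begin
    toℕ (i +ₙ (c ×ₙ i))               ≡⟨ toℕ-+ₙ i (c ×ₙ i) ⟩
    (toℕ i + toℕ (c ×ₙ i)) % N        ≡⟨ cong (λ z → (toℕ i + z) % N) (toℕ-×ₙ c i) ⟩
    (toℕ i + (c * toℕ i) % N) % N     ≡⟨ %-absorbʳ (toℕ i) (c * toℕ i) ⟩
    (toℕ i + c * toℕ i) % N           ∎

  N∣toℕ⇒zero : (i : Fin N) → N ∣ toℕ i → i ≡ zero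
  N∣toℕ⇒zero i N∣i = toℕ-injective (begin
    toℕ i      ≡⟨ m<n⇒m%n≡m (toℕ<n i) ⟨
    toℕ i % N  ≡⟨ n∣m⇒m%n≡0 (toℕ i) N N∣i ⟩
    0          ∎)

module Dihedral (m : ℕ) where
  open ZMod m public

  e : D N
  e = (false , zero)

  ·-identityˡ : (x : D N) → e · x ≡ x
  ·-identityˡ (s , i) = cong (s ,_) (+ₙ-identityˡ i)

  ·-identityʳ : (x : D N) → x · e ≡ x
  ·-identityʳ (false , i) = cong (false ,_) (+ₙ-identityʳ i)
  ·-identityʳ (true , i) = cong (true ,_) (trans (cong (i +ₙ_) ε⁻¹≈ε) (+ₙ-identityʳ i))

  ·-inverseʳ : (x : D N) → x · inv x ≡ e
  ·-inverseʳ (false , i) = cong (false ,_) (+ₙ-inverseʳ i)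
  ·-inverseʳ (true , i) = cong (false ,_) (+ₙ-inverseʳ i)

  conjugate-kind : (g h : D N) → proj₁ ((g · h) · inv g) ≡ proj₁ h
  conjugate-kind (false , _) (false , _) = refl
  conjugate-kind (false , _) (true , _) = refl
  conjugate-kind (true , _) (false , _) = refl
  conjugate-kind (true , _) (true , _) = refl

  rotation·reflection : (k j : Fin N) → (false , k +ₙ (-ₙ j)) · (true , j) ≡ (true , k)
  rotation·reflection k j = cong (true ,_) (begin
    (k +ₙ (-ₙ j)) +ₙ j   ≡⟨ +ₙ-assoc k (-ₙ j) j ⟩
    k +ₙ ((-ₙ j) +ₙ j)   ≡⟨ cong (k +ₙ_) (+ₙ-inverseˡ j) ⟩
    k +ₙ zero            ≡⟨ +ₙ-identityʳ k ⟩
    k                    ∎)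

  identity∈ : {H : Subset N} → IsSubgroup H → e ∈ H
  identity∈ {H} H≤ =
    let (x , x∈) = nonempty in
    subst (_∈ H) (·-inverseʳ x) (·-closed x (inv x) x∈ (inv-closed x x∈))
    where open IsSubgroup H≤

  -- A subgroup containing every rotation is normal: with a rotation it contains all
  -- rotations, with a reflection all reflections, and conjugation preserves the kind.
  all-rotations⇒normal : {H : Subset N} → IsSubgroup H → (∀ k → (false , k) ∈ H) → IsNormal H
  all-rotations⇒normal {H} H≤ rotations g (s , j) h∈ =
    subst (λ t → (t , proj₂ c) ∈ H) (sym (conjugate-kind g (s , j))) (same-kind s h∈ (proj₂ c))
    where
    open IsSubgroup H≤
    c : D N
    c = (g · (s , j)) · inv g
    same-kind : ∀ s → (s , j) ∈ H → ∀ k → (s , k) ∈ H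
    same-kind false _ k = rotations k
    same-kind true h∈ k =
      subst (_∈ H) (rotation·reflection k j) (·-closed _ _ (rotations (k +ₙ (-ₙ j))) h∈)

  -- If H ⊆ K are subgroups then HK = K = KH.
  nested⇒permute : {H K : Subset N} → IsSubgroup H → IsSubgroup K →
                   (∀ x → x ∈ H → x ∈ K) → Permute H K
  nested⇒permute {H} {K} H≤ K≤ H⊆K x = to , from
    where
    open IsSubgroup K≤ using (·-closed)
    to : x ∈ H ⋆ K → x ∈ K ⋆ H
    to (h , k , h∈ , k∈ , refl) =
      h · k , e , ·-closed h k (H⊆K h h∈) k∈ , identity∈ H≤ , sym (·-identityʳ (h · k))
    from : x ∈ K ⋆ H → x ∈ H ⋆ K
    from (k , h , k∈ , h∈ , refl) =
      e , k · h , identity∈ H≤ , ·-closed k h k∈ (H⊆K h h∈) , sym (·-identityˡ (k · h))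

  record ReflectionPair (H : Subset N) (i : Fin N) : Set where
    field
      e∈ : e ∈ H
      reflection∈ : (true , i) ∈ H
      only : ∀ x → x ∈ H → x ≡ e ⊎ x ≡ (true , i)

  -- {e, aⁱb} is a subgroup since the reflection aⁱb is an involution.
  reflectionPair⇒subgroup : {H : Subset N} {i : Fin N} → ReflectionPair H i → IsSubgroup H
  reflectionPair⇒subgroup {H} P = record
    { nonempty = e , e∈
    ; ·-closed = closed
    ; inv-closed = inv-closed
    }
    where
    open ReflectionPair P
    closed : ∀ x y → x ∈ H → y ∈ H → (x · y) ∈ H
    closed x y x∈ y∈ with only x x∈ | only y y∈
    ... | inj₁ refl | _         = subst (_∈ H) (sym (·-identityˡ y)) y∈
    ... | inj₂ refl | inj₁ refl = subst (_∈ H) (sym (·-identityʳ x)) x∈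
    ... | inj₂ refl | inj₂ refl = subst (_∈ H) (sym (·-inverseʳ x)) e∈
    inv-closed : ∀ x → x ∈ H → inv x ∈ H
    inv-closed x x∈ with only x x∈
    ... | inj₁ refl = subst (λ k → (false , k) ∈ H) (sym ε⁻¹≈ε) e∈
    ... | inj₂ refl = reflection∈

  reflectionPair-⊆ : {H K : Subset N} {i : Fin N} →
                     ReflectionPair H i → ReflectionPair K i → ∀ x → x ∈ H → x ∈ K
  reflectionPair-⊆ P Q x x∈ with ReflectionPair.only P x x∈
  ... | inj₁ refl = ReflectionPair.e∈ Q
  ... | inj₂ refl = ReflectionPair.reflection∈ Q

  reflectionPair-ext : {H K : Subset N} {i : Fin N} →
                       ReflectionPair H i → ReflectionPair K i → ∀ x → H x ≡ K x
  reflectionPair-ext P Q x = ⇔→≡ (mk⇔ (reflectionPair-⊆ P Q x) (reflectionPair-⊆ Q P x))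

  commute⇒⋆-swap : {H K : Subset N} {i j : Fin N} → ReflectionPair H i → ReflectionPair K j →
                   (true , i) · (true , j) ≡ (true , j) · (true , i) →
                   ∀ x → x ∈ H ⋆ K → x ∈ K ⋆ H
  commute⇒⋆-swap P Q rs≡sr x (h , k , h∈ , k∈ , refl)
    with ReflectionPair.only P h h∈ | ReflectionPair.only Q k k∈
  ... | inj₁ refl | inj₁ refl = e , e , k∈ , h∈ , refl
  ... | inj₁ refl | inj₂ refl = k , e , k∈ , h∈ , trans (·-identityˡ k) (sym (·-identityʳ k))
  ... | inj₂ refl | inj₁ refl = e , h , k∈ , h∈ , trans (·-identityʳ h) (sym (·-identityˡ h))
  ... | inj₂ refl | inj₂ refl = k , h , k∈ , h∈ , rs≡sr

  -- Conversely, the rotation rs lies in {e, s}{e, r} only as e = e·e or as sr.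
  ⋆-swap⇒commute : {H K : Subset N} {i j : Fin N} → ReflectionPair H i → ReflectionPair K j →
                   ((true , i) · (true , j)) ∈ K ⋆ H →
                   (true , i) · (true , j) ≡ (true , j) · (true , i)
  ⋆-swap⇒commute {i = i} {j} P Q (k , h , k∈ , h∈ , rs≡kh)
    with ReflectionPair.only Q k k∈ | ReflectionPair.only P h h∈
  ... | inj₁ refl | inj₁ refl =
    subst (λ t → (true , t) · (true , j) ≡ (true , j) · (true , t)) (sym i≡j) refl
    where
    i≡j : i ≡ j
    i≡j = x∙y⁻¹≈ε⇒x≈y i j (trans (cong proj₂ rs≡kh) (+ₙ-identityˡ zero))
  ... | inj₁ refl | inj₂ refl = contradiction (cong proj₁ rs≡kh) λ ()
  ... | inj₂ refl | inj₁ refl = contradiction (cong proj₁ rs≡kh) λ ()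
  ... | inj₂ refl | inj₂ refl = rs≡kh

  reflectionPairs-permute⇔commute :
    {H K : Subset N} {i j : Fin N} → ReflectionPair H i → ReflectionPair K j →
    Permute H K ⇔ ((true , i) · (true , j) ≡ (true , j) · (true , i))
  reflectionPairs-permute⇔commute {H} {K} {i} {j} P Q = mk⇔
    (λ perm → ⋆-swap⇒commute P Q (proj₁ (perm _) rs∈HK))
    (λ rs≡sr x → commute⇒⋆-swap P Q rs≡sr x , commute⇒⋆-swap Q P (sym rs≡sr) x)
    where
    rs∈HK : ((true , i) · (true , j)) ∈ H ⋆ K
    rs∈HK = (true , i) , (true , j) , ReflectionPair.reflection∈ P , ReflectionPair.reflection∈ Q , refl

module OddPrime (k : ℕ) (N-prime : Prime (suc (suc k))) (N-odd : ¬ 2 ∣ suc (suc k)) where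
  open Dihedral (suc k)

  -- Bézout: some multiple of a nonzero residue is 1 or -1.
  multiple≡±one : (i : Fin N) → i ≢ zero → ∃[ c ] (c ×ₙ i ≡ one ⊎ c ×ₙ i ≡ -ₙ one)
  multiple≡±one i i≢0
    with coprime-Bézout (prime⇒coprime N-prime {{≢-nonZero (i≢0 ∘ toℕ-injective)}} (toℕ<n i))
  ... | Bézout.-+ x y 1+xN≡yi = y , inj₁ (toℕ-injective (begin
    toℕ (y ×ₙ i)        ≡⟨ toℕ-×ₙ y i ⟩
    (y * toℕ i) % N     ≡⟨ cong (_% N) 1+xN≡yi ⟨
    (1 + x * N) % N     ≡⟨ [m+kn]%n≡m%n 1 x N ⟩
    1                   ∎))
  ... | Bézout.+- x y 1+yi≡xN = y , inj₂ (toℕ-injective (begin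
    toℕ (y ×ₙ i)        ≡⟨ toℕ-×ₙ y i ⟩
    (y * toℕ i) % N     ≡⟨ %-pred-≡0 {y * toℕ i} (trans (cong (_% N) 1+yi≡xN) (m*n%n≡0 x N)) ⟩
    N ∸ 1               ≡⟨ m<n⇒m%n≡m (n<1+n (suc k)) ⟨
    (N ∸ 1) % N         ≡⟨ toℕ--ₙ one ⟨
    toℕ (-ₙ one)        ∎))

  multiple-of-one : (j : Fin N) → toℕ j ×ₙ one ≡ j
  multiple-of-one j = toℕ-injective (begin
    toℕ (toℕ j ×ₙ one)   ≡⟨ toℕ-×ₙ (toℕ j) one ⟩
    (toℕ j * 1) % N      ≡⟨ cong (_% N) (*-identityʳ (toℕ j)) ⟩
    toℕ j % N            ≡⟨ m<n⇒m%n≡m (toℕ<n j) ⟩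
    toℕ j                ∎)

  -- ℤ/N has no element of order 2: N ∣ 2d forces N ∣ d since N is an odd prime.
  double≡zero⇒zero : (d : Fin N) → d +ₙ d ≡ zero → d ≡ zero
  double≡zero⇒zero d d+d≡0 with euclidsLemma 2 (toℕ d) N-prime N∣2d
    where
    N∣2d : N ∣ 2 * toℕ d
    N∣2d = m%n≡0⇒n∣m (2 * toℕ d) N (begin
      (2 * toℕ d) % N         ≡⟨ cong (λ t → (toℕ d + t) % N) (+-identityʳ (toℕ d)) ⟩
      (toℕ d + toℕ d) % N     ≡⟨ toℕ-+ₙ d d ⟨
      toℕ (d +ₙ d)            ≡⟨ cong toℕ d+d≡0 ⟩
      0                       ∎)
  ... | inj₁ N∣2 = contradiction (subst (2 ∣_) (sym (≤-antisym (∣⇒≤ N∣2) (s≤s (s≤s z≤n)))) ∣-refl) N-odd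
  ... | inj₂ N∣d = N∣toℕ⇒zero d N∣d

  -- aⁱb · aʲb = a^(i-j) and aʲb · aⁱb = a^(j-i); they agree only when i = j.
  commuting-reflections⇒equal : (i j : Fin N) →
    (true , i) · (true , j) ≡ (true , j) · (true , i) → i ≡ j
  commuting-reflections⇒equal i j rs≡sr = x∙y⁻¹≈ε⇒x≈y i j (double≡zero⇒zero d (begin
    d +ₙ d          ≡⟨ cong (d +ₙ_) (trans (cong proj₂ rs≡sr) (sym (⁻¹-anti-homo‿- i j))) ⟩
    d +ₙ (-ₙ d)     ≡⟨ +ₙ-inverseʳ d ⟩
    zero            ∎))
    where
    d : Fin N
    d = i +ₙ (-ₙ j)

  module _ {H : Subset N} (H≤ : IsSubgroup H) where
    open IsSubgroup H≤

    multiples∈ : {i : Fin N} → (false , i) ∈ H → ∀ c → (false , c ×ₙ i) ∈ H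
    multiples∈ i∈ zero = identity∈ H≤
    multiples∈ i∈ (suc c) = ·-closed _ _ i∈ (multiples∈ i∈ c)

    one∈ : {i : Fin N} → (false , i) ∈ H → i ≢ zero → (false , one) ∈ H
    one∈ {i} i∈ i≢0 with multiple≡±one i i≢0
    ... | c , inj₁ c·i≡1 = subst (λ t → (false , t) ∈ H) c·i≡1 (multiples∈ i∈ c)
    ... | c , inj₂ c·i≡-1 = subst (λ t → (false , t) ∈ H) (⁻¹-involutive one)
      (inv-closed _ (subst (λ t → (false , t) ∈ H) c·i≡-1 (multiples∈ i∈ c)))

    -- Since N is prime, any nonzero rotation generates the whole rotation subgroup.
    nonzero-rotation⇒all-rotations : {i : Fin N} → (false , i) ∈ H → i ≢ zero →
                                     ∀ j → (false , j) ∈ H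
    nonzero-rotation⇒all-rotations i∈ i≢0 j =
      subst (λ t → (false , t) ∈ H) (multiple-of-one j) (multiples∈ (one∈ i∈ i≢0) (toℕ j))

  -- Every vertex of Γ_N(D_N) is {e, aⁱb} for some i: it contains no nonzero rotation
  -- (else it would be normal), hence at least one and at most one reflection.
  vertex⇒reflectionPair : {H : Subset N} → IsVertex H → ∃[ i ] ReflectionPair H i
  vertex⇒reflectionPair {H} (H≤ , _ , ¬normal) =
    let (i , i∈) = some-reflection in
    i , record { e∈ = identity∈ H≤ ; reflection∈ = i∈ ; only = only i i∈ }
    where
    open IsSubgroup H≤

    rotation∈⇒zero : {j : Fin N} → (false , j) ∈ H → j ≡ zero
    rotation∈⇒zero {j} j∈ = decidable-stable (j Fin.≟ zero)
      (λ j≢0 → ¬normal (all-rotations⇒normal H≤ (nonzero-rotation⇒all-rotations H≤ j∈ j≢0)))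

    no-reflection⇒normal : ¬ (∃[ i ] (true , i) ∈ H) → IsNormal H
    no-reflection⇒normal none g (true , j) j∈ = contradiction (j , j∈) none
    no-reflection⇒normal none g (false , j) j∈ with rotation∈⇒zero j∈
    ... | refl = subst (_∈ H) (sym (trans (cong (_· inv g) (·-identityʳ g)) (·-inverseʳ g))) (identity∈ H≤)

    some-reflection : ∃[ i ] (true , i) ∈ H
    some-reflection = decidable-stable (any? (λ i → H (true , i) Bool.≟ true))
      (λ none → ¬normal (no-reflection⇒normal none))

    only : ∀ i → (true , i) ∈ H → ∀ x → x ∈ H → x ≡ e ⊎ x ≡ (true , i)
    only i i∈ (false , j) j∈ = inj₁ (cong (false ,_) (rotation∈⇒zero j∈))
    only i i∈ (true , j) j∈ =
      inj₂ (cong (true ,_) (sym (x∙y⁻¹≈ε⇒x≈y i j (rotation∈⇒zero (·-closed _ _ i∈ j∈)))))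

  noEdges : NoEdges N
  noEdges H K H-vertex K-vertex (x , Hx≢Kx) perm =
    let (i , P) = vertex⇒reflectionPair H-vertex
        (j , Q) = vertex⇒reflectionPair K-vertex
        i≡j = commuting-reflections⇒equal i j (Equivalence.to (reflectionPairs-permute⇔commute P Q) perm)
    in Hx≢Kx (reflectionPair-ext P (subst (ReflectionPair K) (sym i≡j) Q) x)

module LargeDivisor (k : ℕ) where
  open Dihedral (suc (suc k)) public

  -- The subgroup ⟨aᵈ, b⟩ = { aⁱbˢ | d ∣ i }.
  DihedralSubgroup : ℕ → Subset N
  DihedralSubgroup d (_ , i) = isYes (d ∣? toℕ i)

  ∈DihedralSubgroup⁺ : {d : ℕ} (x : D N) → d ∣ toℕ (proj₂ x) → x ∈ DihedralSubgroup d
  ∈DihedralSubgroup⁺ _ d∣i = Equivalence.to T-≡ (fromWitness d∣i)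

  ∈DihedralSubgroup⁻ : {d : ℕ} (x : D N) → x ∈ DihedralSubgroup d → d ∣ toℕ (proj₂ x)
  ∈DihedralSubgroup⁻ _ x∈ = toWitness (Equivalence.from T-≡ x∈)

  module _ {d : ℕ} (d∣N : d ∣ N) where

    ∣-+ₙ : {i j : Fin N} → d ∣ toℕ i → d ∣ toℕ j → d ∣ toℕ (i +ₙ j)
    ∣-+ₙ {i} {j} d∣i d∣j = subst (d ∣_) (sym (toℕ-+ₙ i j)) (%-presˡ-∣ (∣m∣n⇒∣m+n d∣i d∣j) d∣N)

    ∣--ₙ : {i : Fin N} → d ∣ toℕ i → d ∣ toℕ (-ₙ i)
    ∣--ₙ {i} d∣i = subst (d ∣_) (sym (toℕ--ₙ i)) (%-presˡ-∣ d∣N-i d∣N)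
      where
      d∣N-i : d ∣ N ∸ toℕ i
      d∣N-i = ∣m+n∣m⇒∣n (subst (d ∣_) (sym (m+[n∸m]≡n (<⇒≤ (toℕ<n i)))) d∣N) d∣i

    dihedralSubgroup : IsSubgroup (DihedralSubgroup d)
    dihedralSubgroup = record
      { nonempty = e , ∈DihedralSubgroup⁺ e (d ∣0)
      ; ·-closed = closed
      ; inv-closed = inv-closed
      }
      where
      closed : ∀ x y → x ∈ DihedralSubgroup d → y ∈ DihedralSubgroup d →
               (x · y) ∈ DihedralSubgroup d
      closed x@(false , _) y x∈ y∈ =
        ∈DihedralSubgroup⁺ (x · y) (∣-+ₙ (∈DihedralSubgroup⁻ x x∈) (∈DihedralSubgroup⁻ y y∈))
      closed x@(true , _) y x∈ y∈ =
        ∈DihedralSubgroup⁺ (x · y) (∣-+ₙ (∈DihedralSubgroup⁻ x x∈) (∣--ₙ (∈DihedralSubgroup⁻ y y∈)))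
      inv-closed : ∀ x → x ∈ DihedralSubgroup d → inv x ∈ DihedralSubgroup d
      inv-closed x@(false , _) x∈ = ∈DihedralSubgroup⁺ (inv x) (∣--ₙ (∈DihedralSubgroup⁻ x x∈))
      inv-closed (true , _) x∈ = x∈

    -- For d ≥ 3, ⟨aᵈ, b⟩ misses a, and is not normal as it misses a·b·a⁻¹ = a²b.
    dihedralSubgroup-vertex : 3 ≤ d → IsVertex (DihedralSubgroup d)
    dihedralSubgroup-vertex 3≤d =
      dihedralSubgroup , ((false , one) , a∉) , ¬normal
      where
      a∉ : ¬ (false , one) ∈ DihedralSubgroup d
      a∉ a∈ = large∤small 3≤d (s≤s (s≤s z≤n)) (∈DihedralSubgroup⁻ (false , one) a∈)
      aba⁻¹ : D N
      aba⁻¹ = ((false , one) · (true , zero)) · inv (false , one)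
      aba⁻¹≡a²b : toℕ (proj₂ aba⁻¹) ≡ 2
      aba⁻¹≡a²b = cong toℕ (cong₂ _+ₙ_ (+ₙ-identityʳ one) (⁻¹-involutive one))
      ¬normal : ¬ IsNormal (DihedralSubgroup d)
      ¬normal normal = large∤small 3≤d (s≤s (s≤s (s≤s z≤n)))
        (subst (d ∣_) aba⁻¹≡a²b (∈DihedralSubgroup⁻ aba⁻¹
          (normal (false , one) (true , zero) (∈DihedralSubgroup⁺ (true , zero) (d ∣0)))))

  -- A divisor 3 ≤ d < N yields the edge ⟨b⟩ = ⟨aᴺ, b⟩ ⊊ ⟨aᵈ, b⟩.
  largeDivisor⇒edge : {d : ℕ} → d ∣ N → 3 ≤ d → d < N → ¬ NoEdges N
  largeDivisor⇒edge {d} d∣N 3≤d d<N noEdges =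
    noEdges (DihedralSubgroup N) (DihedralSubgroup d)
            (dihedralSubgroup-vertex ∣-refl (s≤s (s≤s (s≤s z≤n)))) (dihedralSubgroup-vertex d∣N 3≤d)
            ((false , aᵈ) , aᵈ∉) perm
    where
    aᵈ : Fin N
    aᵈ = fromℕ< d<N
    aᵈ∉ : DihedralSubgroup N (false , aᵈ) ≢ DihedralSubgroup d (false , aᵈ)
    aᵈ∉ eq = ≤⇒≯ 3≤d (subst (_< 3) 0≡d (s≤s z≤n))
      where
      aᵈ∈ : (false , aᵈ) ∈ DihedralSubgroup d
      aᵈ∈ = ∈DihedralSubgroup⁺ (false , aᵈ) (subst (d ∣_) (sym (toℕ-fromℕ< d<N)) ∣-refl)
      0≡d : 0 ≡ d
      0≡d = trans (cong toℕ (sym (N∣toℕ⇒zero aᵈ (∈DihedralSubgroup⁻ (false , aᵈ) (trans eq aᵈ∈)))))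
                  (toℕ-fromℕ< d<N)
    perm : Permute (DihedralSubgroup N) (DihedralSubgroup d)
    perm = nested⇒permute (dihedralSubgroup ∣-refl) (dihedralSubgroup d∣N)
      λ x x∈ → ∈DihedralSubgroup⁺ x (∣-trans d∣N (∈DihedralSubgroup⁻ x x∈))

-- In D₄ the reflections b and a²b commute, so ⟨b⟩ and ⟨a²b⟩ are adjacent.
module Klein where
  open LargeDivisor 1

  two : Fin 4
  two = suc (suc zero)

  ⟨a²b⟩ : Subset 4
  ⟨a²b⟩ (false , zero) = true
  ⟨a²b⟩ (true , suc (suc zero)) = true
  ⟨a²b⟩ _ = false

  ⟨a²b⟩-pair : ReflectionPair ⟨a²b⟩ two
  ⟨a²b⟩-pair = record { e∈ = refl ; reflection∈ = refl ; only = only }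
    where
    only : ∀ x → x ∈ ⟨a²b⟩ → x ≡ e ⊎ x ≡ (true , two)
    only (false , zero) _ = inj₁ refl
    only (true , suc (suc zero)) _ = inj₂ refl
    only (false , suc _) ()
    only (true , zero) ()
    only (true , suc zero) ()
    only (true , suc (suc (suc zero))) ()

  ⟨b⟩-pair : ReflectionPair (DihedralSubgroup 4) zero
  ⟨b⟩-pair = record { e∈ = refl ; reflection∈ = refl ; only = only }
    where
    only : ∀ x → x ∈ DihedralSubgroup 4 → x ≡ e ⊎ x ≡ (true , zero)
    only x@(_ , i) x∈ with N∣toℕ⇒zero i (∈DihedralSubgroup⁻ x x∈)
    only (false , _) _ | refl = inj₁ refl
    only (true , _) _ | refl = inj₂ refl

  ⟨a²b⟩-vertex : IsVertex ⟨a²b⟩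
  ⟨a²b⟩-vertex = reflectionPair⇒subgroup ⟨a²b⟩-pair , ((false , one) , λ ()) , ¬normal
    where
    ¬normal : ¬ IsNormal ⟨a²b⟩
    ¬normal normal with normal (false , one) (true , two) refl
    ... | ()

  klein : ¬ NoEdges 4
  klein noEdges =
    noEdges (DihedralSubgroup 4) ⟨a²b⟩
            (dihedralSubgroup-vertex ∣-refl (s≤s (s≤s (s≤s z≤n)))) ⟨a²b⟩-vertex
            ((true , two) , λ ())
            (Equivalence.from (reflectionPairs-permute⇔commute ⟨b⟩-pair ⟨a²b⟩-pair) refl)

HasLargeProperDivisor : ℕ → Set
HasLargeProperDivisor n = ∃[ d ] (d ∣ n × 3 ≤ d × d < n)

-- n = 2q with q ≥ 3 has the divisor q; the only other even n ≥ 3 is 4.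
even⇒four-or-large : {n : ℕ} → 3 ≤ n → 2 ∣ n → n ≡ 4 ⊎ HasLargeProperDivisor n
even⇒four-or-large 3≤n (divides 0 refl) = contradiction 3≤n λ ()
even⇒four-or-large 3≤n (divides 1 refl) = contradiction 3≤n λ { (s≤s (s≤s ())) }
even⇒four-or-large 3≤n (divides 2 refl) = inj₁ refl
even⇒four-or-large 3≤n (divides q@(suc (suc (suc _))) refl) =
  inj₂ (q , divides 2 (*-comm q 2) , s≤s (s≤s (s≤s z≤n)) , m<m*n q 2 (s≤s (s≤s z≤n)))

composite⇒four-or-large : {n : ℕ} → 3 ≤ n → Composite n → n ≡ 4 ⊎ HasLargeProperDivisor n
composite⇒four-or-large 3≤n (hasNonTrivialDivisor {d} d<n d∣n)
  with m≤n⇒m<n∨m≡n (nonTrivial⇒n>1 d)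
... | inj₁ 3≤d = inj₂ (d , d∣n , 3≤d , d<n)
... | inj₂ refl = even⇒four-or-large 3≤n d∣n

theorem4p3 : (n : ℕ) → 3 ≤ n → (NoEdges n ⇔ (Prime n × ¬ (2 ∣ n)))
theorem4p3 1 (s≤s ())
theorem4p3 2 (s≤s (s≤s ()))
theorem4p3 n@(suc (suc (suc k))) 3≤n = mk⇔ forward backward
  where
  edge : n ≡ 4 ⊎ HasLargeProperDivisor n → ¬ NoEdges n
  edge (inj₁ n≡4) = subst (λ m → ¬ NoEdges m) (sym n≡4) Klein.klein
  edge (inj₂ (d , d∣n , 3≤d , d<n)) = LargeDivisor.largeDivisor⇒edge k d∣n 3≤d d<n

  forward : NoEdges n → Prime n × ¬ 2 ∣ n
  forward noEdges =
    decidable-stable (prime? n)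
      (λ ¬prime → edge (composite⇒four-or-large 3≤n (¬prime⇒composite ¬prime)) noEdges) ,
    (λ even → edge (even⇒four-or-large 3≤n even) noEdges)

  backward : Prime n × ¬ 2 ∣ n → NoEdges n
  backward (n-prime , n-odd) = OddPrime.noEdges (suc k) n-prime n-odd
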